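{- Let $X$ be an indeterminate and $n$ a positive integer. The determinant of the $n\times n$ matrix \[ \Bigl(\binom{i}{j}X+\binom{i+2}{j+1}\Bigr)_{0\le i,j<n} \] equals \[ \sum_{h}\binom{n+1+h}{2h+1}X^h . \]
   Context: Sums over $h$ run over all integers $h$ with finitely many nonzero terms; binomial coefficients $\binom ab$ with $a,b$ nonnegative integers are the usual ones, zero when $b>a$ or $b<0$. -}

module Defs where

open import Level using (Level)
open import Data.Nat using (ℕ; zero; suc)
import Data.Nat as N
open import Data.Nat.Combinatorics using (_C_)
open import Data.Fin using (Fin; zero; suc; toℕ; punchIn)
open import Algebra.Bundles using (CommutativeRing)
import Algebra.Bundles
import Algebra.Definitions.RawSemiring as RS

module RingDefs {c ℓ : Level} (R : CommutativeRing c ℓ) where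
  open CommutativeRing R using (Carrier; _+_; _*_; -_; 0#; 1#; semiring)
  open RS (Algebra.Bundles.Semiring.rawSemiring semiring) public using (_×_; _^_)

  Σℕ : ℕ → (ℕ → Carrier) → Carrier
  Σℕ zero    f = 0#
  Σℕ (suc n) f = Σℕ n f + f n

  ΣFin : (n : ℕ) → (Fin n → Carrier) → Carrier
  ΣFin zero    f = 0#
  ΣFin (suc n) f = f zero + ΣFin n (λ j → f (suc j))

  minor : {n : ℕ} → (Fin (suc n) → Fin (suc n) → Carrier) → Fin (suc n)
        → Fin n → Fin n → Carrier
  minor M j r c = M (suc r) (punchIn j c)

  det : (n : ℕ) → (Fin n → Fin n → Carrier) → Carrier
  det zero    M = 1#
  det (suc n) M =
    ΣFin (suc n) (λ j → ((- 1#) ^ toℕ j) * (M zero j * det n (minor M j)))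

  ι : ℕ → Carrier
  ι n = n × 1#

  binomMatrix : (n : ℕ) → Carrier → Fin n → Fin n → Carrier
  binomMatrix n x i j =
    ι (toℕ i C toℕ j) * x + ι ((toℕ i N.+ 2) C (toℕ j N.+ 1))

  -- sum_h C(n+1+h, 2h+1) X^h ; terms with h < 0 or h > n vanish
  rhsSum : ℕ → Carrier → Carrier
  rhsSum n x = Σℕ (suc n) (λ h → ι ((n N.+ 1 N.+ h) C (2 N.* h N.+ 1)) * (x ^ h))

module Submission where

-- Extend the matrix to an ℕ × ℕ matrix A and let D k be its leading k × k
-- minor.  A is lower Hessenberg with ones on the superdiagonal; expanding
-- along the first row shows that every row of such a matrix annihilates
-- the signed minors (-1)^k D k  (hessenberg-kernel).  By Pascal's rule,
-- pairing row m of A with a sequence w yields the m-th binomial transform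
-- of  L w l = (X+2) w_l + w_{l-1} + w_{l+1}  (row-transform).  The binomial
-- transform is unitriangular, so L kills the signed minors, which says
-- D 1 = X+2 and D (l+2) = (X+2) D (l+1) - D l.  The right-hand side obeys
-- the same recurrence with the same initial values, by a coefficientwise
-- Pascal identity (rhsCoeff-recurrence), so D n = F n.

open import Defs
open import Level using (Level)
open import Data.Nat using (ℕ; zero; suc)
open import Algebra.Bundles using (CommutativeRing)
import Data.Nat as N
import Data.Nat.Properties as NP
open import Data.Nat.Combinatorics using (_C_; nC1≡n; nCn≡1; k>n⇒nCk≡0)
  renaming (nCk+nC[k+1]≡[n+1]C[k+1] to pascal)
open import Data.Nat.Tactic.RingSolver using (solve-∀)
open import Relation.Binary.PropositionalEquality as ≡ using (_≡_)

module BinomialFacts where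
  open N using (_+_; _*_; _<_; s≤s)
  open ≡.≡-Reasoning

  pascal-twice : ∀ n k →
    (2 + n) C (2 + k) + n C (2 + k) ≡ ((1 + n) C (2 + k) + (1 + n) C (2 + k)) + n C k
  pascal-twice n k = begin
    (2 + n) C (2 + k) + r        ≡⟨ ≡.cong (_+ r) (≡.sym (pascal (1 + n) (1 + k))) ⟩
    ((1 + n) C (1 + k) + s) + r  ≡⟨ ≡.cong (λ t → (t + s) + r) (≡.sym (pascal n k)) ⟩
    ((p + q) + s) + r            ≡⟨ regroup p q s r ⟩
    (s + (q + r)) + p            ≡⟨ ≡.cong (λ t → (s + t) + p) (pascal n (1 + k)) ⟩
    (s + s) + p                  ∎
    where
    p = n C k
    q = n C (1 + k)
    r = n C (2 + k)
    s = (1 + n) C (2 + k)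
    regroup : ∀ p q s r → ((p + q) + s) + r ≡ (s + (q + r)) + p
    regroup = solve-∀

  rhsCoeff : ℕ → ℕ → ℕ
  rhsCoeff n h = (n + 1 + h) C (2 * h + 1)

  mulX : (ℕ → ℕ) → ℕ → ℕ
  mulX c zero    = 0
  mulX c (suc h) = c h

  -- rhsCoeff with its indices brought into the shape Pascal's rule needs.
  rhsCoeff-shape : ∀ n h → rhsCoeff n h ≡ suc (n + h) C (2 * h + 1)
  rhsCoeff-shape n h = ≡.cong (_C (2 * h + 1)) (top n h)
    where
    top : ∀ n h → n + 1 + h ≡ suc (n + h)
    top = solve-∀

  rhsCoeff-suc : ∀ n h → rhsCoeff n (suc h) ≡ suc (suc (n + h)) C (2 + (2 * h + 1))
  rhsCoeff-suc n h = ≡.cong₂ _C_ (top n h) (bottom h)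
    where
    top : ∀ n h → n + 1 + suc h ≡ suc (suc (n + h))
    top = solve-∀
    bottom : ∀ h → 2 * suc h + 1 ≡ 2 + (2 * h + 1)
    bottom = solve-∀

  rhsCoeff-vanishes : ∀ n h → n < h → rhsCoeff n h ≡ 0
  rhsCoeff-vanishes n h n<h = ≡.trans (rhsCoeff-shape n h)
    (k>n⇒nCk≡0 (≡.subst (suc (n + h) <_) (≡.sym (double+1 h)) (s≤s (NP.+-monoˡ-≤ h n<h))))
    where
    double+1 : ∀ h → 2 * h + 1 ≡ suc (h + h)
    double+1 = solve-∀

  -- Coefficientwise form of  F(n+2) + F(n) = (2 + X) F(n+1).
  rhsCoeff-recurrence : ∀ n h →
    rhsCoeff (2 + n) h + rhsCoeff n h ≡ (rhsCoeff (1 + n) h + rhsCoeff (1 + n) h) + mulX (rhsCoeff (1 + n)) h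
  rhsCoeff-recurrence n zero = begin
    a C 1 + b C 1          ≡⟨ ≡.cong₂ _+_ (nC1≡n a) (nC1≡n b) ⟩
    a + b                  ≡⟨ linear n ⟩
    (c + c) + 0            ≡⟨ ≡.cong (λ t → (t + t) + 0) (≡.sym (nC1≡n c)) ⟩
    (c C 1 + c C 1) + 0    ∎
    where
    a = 2 + n + 1 + 0
    b = n + 1 + 0
    c = 1 + n + 1 + 0
    linear : ∀ n → (2 + n + 1 + 0) + (n + 1 + 0) ≡ ((1 + n + 1 + 0) + (1 + n + 1 + 0)) + 0
    linear = solve-∀
  rhsCoeff-recurrence n (suc h) = begin
    rhsCoeff (2 + n) (suc h) + rhsCoeff n (suc h)
      ≡⟨ ≡.cong₂ _+_ (rhsCoeff-suc (2 + n) h) (rhsCoeff-suc n h) ⟩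
    (2 + m) C (2 + k) + m C (2 + k)
      ≡⟨ pascal-twice m k ⟩
    ((1 + m) C (2 + k) + (1 + m) C (2 + k)) + m C k
      ≡⟨ ≡.sym (≡.cong₂ (λ a b → (a + a) + b) (rhsCoeff-suc (1 + n) h) (rhsCoeff-shape (1 + n) h)) ⟩
    (rhsCoeff (1 + n) (suc h) + rhsCoeff (1 + n) (suc h)) + rhsCoeff (1 + n) h ∎
    where
    m = suc (suc (n + h))
    k = 2 * h + 1

module IntegerCoefficientSolver {c ℓ : Level} (R : CommutativeRing c ℓ) where
  open CommutativeRing R hiding (zero)
  open import Algebra.Properties.Ring ring using (-0#≈0#; -‿involutive; -‿+-comm; -‿distribˡ-*; -‿distribʳ-*)
  -- The multiples  n × 1#  used here satisfy  1 × 1# = 1#  definitionally,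
  -- so the solver's constants 0 and 1 are literally 0# and 1#.
  open import Algebra.Properties.Semiring.Mult.TCOptimised semiring using (_×_; 1+×; ×-homo-+; ×1-homo-*)
  open import Algebra.Solver.Ring.AlmostCommutativeRing using (fromCommutativeRing; _-Raw-AlmostCommutative⟶_)
  open import Data.Integer as ℤ using (ℤ; +_; -[1+_]; _⊖_)
  import Data.Integer.Properties as ℤP
  import Data.Sign as Sign
  open import Data.Maybe using (Maybe; just; nothing)
  open import Relation.Nullary using (yes; no)
  open import Relation.Binary.Reasoning.Setoid setoid

  ⟦_⟧ℤ : ℤ → Carrier
  ⟦ + n ⟧ℤ      = n × 1#
  ⟦ -[1+ n ] ⟧ℤ = - (suc n × 1#)

  cancel-one : ∀ a b → (1# + a) + - (1# + b) ≈ a + - b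
  cancel-one a b = begin
    (1# + a) + - (1# + b)   ≈⟨ +-cong (+-comm 1# a) (sym (-‿+-comm 1# b)) ⟩
    (a + 1#) + (- 1# + - b) ≈⟨ +-assoc a 1# _ ⟩
    a + (1# + (- 1# + - b)) ≈⟨ +-congˡ (sym (+-assoc 1# (- 1#) (- b))) ⟩
    a + ((1# + - 1#) + - b) ≈⟨ +-congˡ (+-congʳ (-‿inverseʳ 1#)) ⟩
    a + (0# + - b)          ≈⟨ +-congˡ (+-identityˡ _) ⟩
    a + - b                 ∎

  ⊖-homo : ∀ m n → ⟦ m ⊖ n ⟧ℤ ≈ m × 1# + - (n × 1#)
  ⊖-homo zero    zero    = sym (-‿inverseʳ 0#)
  ⊖-homo (suc m) zero    = sym (trans (+-congˡ -0#≈0#) (+-identityʳ _))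
  ⊖-homo zero    (suc n) = sym (+-identityˡ _)
  ⊖-homo (suc m) (suc n) = begin
    ⟦ suc m ⊖ suc n ⟧ℤ                  ≡⟨ ≡.cong ⟦_⟧ℤ (ℤP.[1+m]⊖[1+n]≡m⊖n m n) ⟩
    ⟦ m ⊖ n ⟧ℤ                          ≈⟨ ⊖-homo m n ⟩
    m × 1# + - (n × 1#)                 ≈⟨ cancel-one _ _ ⟨
    (1# + m × 1#) + - (1# + n × 1#)     ≈⟨ +-cong (1+× m 1#) (-‿cong (1+× n 1#)) ⟨
    suc m × 1# + - (suc n × 1#)         ∎

  neg-homo : ∀ i → ⟦ ℤ.- i ⟧ℤ ≈ - ⟦ i ⟧ℤ
  neg-homo (+ zero)  = sym -0#≈0#
  neg-homo (+ suc n) = refl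
  neg-homo -[1+ n ]  = sym (-‿involutive _)

  plus-homo : ∀ i j → ⟦ i ℤ.+ j ⟧ℤ ≈ ⟦ i ⟧ℤ + ⟦ j ⟧ℤ
  plus-homo (+ m)    (+ n)    = ×-homo-+ 1# m n
  plus-homo (+ m)    -[1+ n ] = ⊖-homo m (suc n)
  plus-homo -[1+ m ] (+ n)    = trans (⊖-homo n (suc m)) (+-comm _ _)
  plus-homo -[1+ m ] -[1+ n ] = begin
    - (suc (suc (m N.+ n)) × 1#)         ≡⟨ ≡.cong (λ k → - (k × 1#)) (≡.sym (NP.+-suc (suc m) n)) ⟩
    - ((suc m N.+ suc n) × 1#)           ≈⟨ -‿cong (×-homo-+ 1# (suc m) (suc n)) ⟩
    - (suc m × 1# + suc n × 1#)          ≈⟨ -‿+-comm _ _ ⟨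
    - (suc m × 1#) + - (suc n × 1#)      ∎

  ◃-plus : ∀ k → ⟦ Sign.+ ℤ.◃ k ⟧ℤ ≈ k × 1#
  ◃-plus k = reflexive (≡.cong ⟦_⟧ℤ (ℤP.+◃n≡+n k))

  ◃-minus : ∀ k → ⟦ Sign.- ℤ.◃ k ⟧ℤ ≈ - (k × 1#)
  ◃-minus k = trans (reflexive (≡.cong ⟦_⟧ℤ (ℤP.-◃n≡-n k))) (neg-homo (+ k))

  times-homo : ∀ i j → ⟦ i ℤ.* j ⟧ℤ ≈ ⟦ i ⟧ℤ * ⟦ j ⟧ℤ
  times-homo (+ m) (+ n) = trans (◃-plus (m N.* n)) (×1-homo-* m n)
  times-homo (+ m) -[1+ n ] =
    trans (◃-minus (m N.* suc n)) (trans (-‿cong (×1-homo-* m (suc n))) (-‿distribʳ-* _ _))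
  times-homo -[1+ m ] (+ n) =
    trans (◃-minus (suc m N.* n)) (trans (-‿cong (×1-homo-* (suc m) n)) (-‿distribˡ-* _ _))
  times-homo -[1+ m ] -[1+ n ] = begin
    ⟦ Sign.+ ℤ.◃ (suc m N.* suc n) ⟧ℤ ≈⟨ ◃-plus (suc m N.* suc n) ⟩
    (suc m N.* suc n) × 1#           ≈⟨ ×1-homo-* (suc m) (suc n) ⟩
    a * b                            ≈⟨ -‿involutive _ ⟨
    - - (a * b)                      ≈⟨ -‿cong (-‿distribʳ-* a b) ⟩
    - (a * - b)                      ≈⟨ -‿distribˡ-* a (- b) ⟩
    - a * - b                        ∎
    where
    a = suc m × 1#
    b = suc n × 1#

  morphism : ℤ.+-*-rawRing -Raw-AlmostCommutative⟶ fromCommutativeRing R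
  morphism = record
    { ⟦_⟧    = ⟦_⟧ℤ
    ; +-homo = plus-homo
    ; *-homo = times-homo
    ; -‿homo = neg-homo
    ; 0-homo = refl
    ; 1-homo = refl
    }

  coefficient-equality : ∀ i j → Maybe (⟦ i ⟧ℤ ≈ ⟦ j ⟧ℤ)
  coefficient-equality i j with i ℤP.≟ j
  ... | yes ≡.refl = just refl
  ... | no _       = nothing

  open import Algebra.Solver.Ring ℤ.+-*-rawRing (fromCommutativeRing R) morphism coefficient-equality public

  :0 :1 : ∀ {n} → Polynomial n
  :0 = con (+ 0)
  :1 = con (+ 1)

module FiniteSums {c ℓ : Level} (R : CommutativeRing c ℓ) where
  open CommutativeRing R hiding (zero)
  open RingDefs R using (Σℕ)
  open import Algebra.Properties.Ring ring using (-0#≈0#; -‿+-comm)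
  open IntegerCoefficientSolver R using (solve; _:=_; _:+_)

  S : ℕ → (ℕ → Carrier) → Carrier
  S zero    f = 0#
  S (suc n) f = f 0 + S n (λ k → f (suc k))

  S-cong : ∀ n {f g : ℕ → Carrier} → (∀ k → f k ≈ g k) → S n f ≈ S n g
  S-cong zero    f≈g = refl
  S-cong (suc n) f≈g = +-cong (f≈g 0) (S-cong n (λ k → f≈g (suc k)))

  S-+ : ∀ n f g → S n (λ k → f k + g k) ≈ S n f + S n g
  S-+ zero    f g = sym (+-identityˡ 0#)
  S-+ (suc n) f g = trans (+-congˡ (S-+ n _ _)) (interchange (f 0) (g 0) _ _)
    where
    interchange : ∀ a b c d → (a + b) + (c + d) ≈ (a + c) + (b + d)
    interchange = solve 4 (λ a b c d → (a :+ b) :+ (c :+ d) := (a :+ c) :+ (b :+ d)) refl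

  S-* : ∀ n a f → S n (λ k → a * f k) ≈ a * S n f
  S-* zero    a f = sym (zeroʳ a)
  S-* (suc n) a f = trans (+-congˡ (S-* n a _)) (sym (distribˡ a _ _))

  S-neg : ∀ n f → S n (λ k → - f k) ≈ - S n f
  S-neg zero    f = sym -0#≈0#
  S-neg (suc n) f = trans (+-congˡ (S-neg n _)) (-‿+-comm _ _)

  S-last : ∀ n f → S (suc n) f ≈ S n f + f n
  S-last zero    f = +-comm _ _
  S-last (suc n) f = trans (+-congˡ (S-last n _)) (sym (+-assoc _ _ _))

  S-pad : ∀ n f → f n ≈ 0# → S (suc n) f ≈ S n f
  S-pad n f fn≈0 = trans (S-last n f) (trans (+-congˡ fn≈0) (+-identityʳ _))

  S-vanishes : ∀ n f → (∀ k → k N.< n → f k ≈ 0#) → S n f ≈ 0#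
  S-vanishes zero    f f≈0 = refl
  S-vanishes (suc n) f f≈0 =
    trans (+-cong (f≈0 0 (N.s≤s N.z≤n)) (S-vanishes n _ (λ k k<n → f≈0 (suc k) (N.s≤s k<n))))
          (+-identityˡ 0#)

  Σℕ≈S : ∀ n f → Σℕ n f ≈ S n f
  Σℕ≈S zero    f = refl
  Σℕ≈S (suc n) f = trans (+-congʳ (Σℕ≈S n f)) (sym (S-last n f))

module AlternatingSums {c ℓ : Level} (R : CommutativeRing c ℓ) where
  open CommutativeRing R hiding (zero)
  open FiniteSums R
  open IntegerCoefficientSolver R using (solve; _:=_; _:+_; _:*_; :-_; _:-_)
  open import Algebra.Properties.Ring ring using (-‿distribˡ-*)
  open import Relation.Binary.Reasoning.Setoid setoid

  sign : ℕ → Carrier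
  sign zero    = 1#
  sign (suc k) = - sign k

  sign-square : ∀ k → sign k * sign k ≈ 1#
  sign-square zero    = *-identityˡ 1#
  sign-square (suc k) = trans (neg-square (sign k)) (sign-square k)
    where
    neg-square : ∀ s → (- s) * (- s) ≈ s * s
    neg-square = solve 1 (λ s → (:- s) :* (:- s) := s :* s) refl

  sign-cancel : ∀ k e → sign k * e ≈ 0# → e ≈ 0#
  sign-cancel k e se≈0 = begin
    e                     ≈⟨ *-identityˡ e ⟨
    1# * e                ≈⟨ *-congʳ (sign-square k) ⟨
    (sign k * sign k) * e ≈⟨ *-assoc _ _ _ ⟩
    sign k * (sign k * e) ≈⟨ *-congˡ se≈0 ⟩
    sign k * 0#           ≈⟨ zeroʳ _ ⟩
    0#                    ∎

  Alt : ℕ → (ℕ → Carrier) → Carrier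
  Alt n f = S n (λ k → sign k * f k)

  Alt-suc : ∀ n f → Alt (suc n) f ≈ f 0 - Alt n (λ k → f (suc k))
  Alt-suc n f = +-cong (*-identityˡ (f 0))
    (trans (S-cong n (λ k → sym (-‿distribˡ-* (sign k) (f (suc k))))) (S-neg n _))

  Alt-linear : ∀ n a f g → Alt n (λ k → a * f k - g k) ≈ a * Alt n f - Alt n g
  Alt-linear n a f g = begin
    Alt n (λ k → a * f k - g k)
      ≈⟨ S-cong n (λ k → distribute (sign k) a (f k) (g k)) ⟩
    S n (λ k → a * (sign k * f k) + - (sign k * g k))
      ≈⟨ S-+ n _ _ ⟩
    S n (λ k → a * (sign k * f k)) + S n (λ k → - (sign k * g k))
      ≈⟨ +-cong (S-* n a _) (S-neg n _) ⟩
    a * Alt n f - Alt n g ∎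
    where
    distribute : ∀ s a f g → s * (a * f - g) ≈ a * (s * f) + - (s * g)
    distribute = solve 4 (λ s a f g → s :* (a :* f :- g) := a :* (s :* f) :+ :- (s :* g)) refl

module UnitHessenberg {c ℓ : Level} (R : CommutativeRing c ℓ) where
  open CommutativeRing R hiding (zero)
  open RingDefs R using (ΣFin; det; minor; _^_)
  open FiniteSums R
  open AlternatingSums R
  open IntegerCoefficientSolver R using (solve; _:=_; _:+_; _:*_; :-_; _:-_; :0; :1)
  open import Data.Fin using (Fin; toℕ; punchIn) renaming (zero to fzero; suc to fsuc)
  open import Relation.Binary.Reasoning.Setoid setoid

  Matrix : Set c
  Matrix = ℕ → ℕ → Carrier

  leading : Matrix → (n : ℕ) → Fin n → Fin n → Carrier
  leading H n i j = H (toℕ i) (toℕ j)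

  D : Matrix → ℕ → Carrier
  D H n = det n (leading H n)

  withoutRow0Col0 : Matrix → Matrix
  withoutRow0Col0 H i j = H (suc i) (suc j)

  withoutRow0Col1 : Matrix → Matrix
  withoutRow0Col1 H i zero    = H (suc i) 0
  withoutRow0Col1 H i (suc j) = H (suc i) (suc (suc j))

  record IsUnitHessenberg (H : Matrix) : Set (c Level.⊔ ℓ) where
    field
      above-zero : ∀ i j → suc (suc i) N.≤ j → H i j ≈ 0#
      super-one  : ∀ i → H i (suc i) ≈ 1#

  -- Both deletions keep the shape, since they remove the first row.
  withoutRow0Col0-hessenberg : ∀ {H} → IsUnitHessenberg H → IsUnitHessenberg (withoutRow0Col0 H)
  withoutRow0Col0-hessenberg h = record
    { above-zero = λ i j le → IsUnitHessenberg.above-zero h (suc i) (suc j) (N.s≤s le)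
    ; super-one  = λ i → IsUnitHessenberg.super-one h (suc i)
    }

  withoutRow0Col1-hessenberg : ∀ {H} → IsUnitHessenberg H → IsUnitHessenberg (withoutRow0Col1 H)
  withoutRow0Col1-hessenberg {H} h = record
    { above-zero = above-zero
    ; super-one  = λ i → IsUnitHessenberg.super-one h (suc i)
    }
    where
    above-zero : ∀ i j → suc (suc i) N.≤ j → withoutRow0Col1 H i j ≈ 0#
    above-zero i (suc j) (N.s≤s le) = IsUnitHessenberg.above-zero h (suc i) (suc (suc j)) (N.s≤s (N.s≤s le))

  ΣFin-cong : ∀ n {f g : Fin n → Carrier} → (∀ j → f j ≈ g j) → ΣFin n f ≈ ΣFin n g
  ΣFin-cong zero    f≈g = refl
  ΣFin-cong (suc n) f≈g = +-cong (f≈g fzero) (ΣFin-cong n (λ j → f≈g (fsuc j)))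

  ΣFin-vanishes : ∀ n (f : Fin n → Carrier) → (∀ j → f j ≈ 0#) → ΣFin n f ≈ 0#
  ΣFin-vanishes zero    f f≈0 = refl
  ΣFin-vanishes (suc n) f f≈0 = trans (+-cong (f≈0 fzero) (ΣFin-vanishes n _ (λ j → f≈0 (fsuc j)))) (+-identityˡ 0#)

  det-cong : ∀ n {M M′ : Fin n → Fin n → Carrier} → (∀ i j → M i j ≈ M′ i j) → det n M ≈ det n M′
  det-cong zero    M≈M′ = refl
  det-cong (suc n) M≈M′ = ΣFin-cong (suc n) λ j →
    *-congˡ {(- 1#) ^ toℕ j} (*-cong (M≈M′ fzero j) (det-cong n (λ r c → M≈M′ (fsuc r) (punchIn j c))))

  D-one : ∀ H → D H 1 ≈ H 0 0
  D-one H = unit-laws (H 0 0)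
    where
    unit-laws : ∀ a → 1# * (a * 1#) + 0# ≈ a
    unit-laws = solve 1 (λ a → :1 :* (a :* :1) :+ :0 := a) refl

  -- Laplace expansion along the first row: only the first two entries of
  -- the row survive, and the second one is 1.
  D-expand : ∀ {H} → IsUnitHessenberg H → ∀ k →
    D H (suc (suc k)) ≈ H 0 0 * D (withoutRow0Col0 H) (suc k) - D (withoutRow0Col1 H) (suc k)
  D-expand {H} h k = begin
    1# * (H 0 0 * D (withoutRow0Col0 H) (suc k)) + ((- 1# * 1#) * (H 0 1 * det (suc k) (minor M (fsuc fzero))) + rest)
      ≈⟨ +-congˡ (+-cong (*-congˡ (*-cong (IsUnitHessenberg.super-one h 0) (det-cong (suc k) second-minor))) rest≈0) ⟩
    1# * (H 0 0 * D (withoutRow0Col0 H) (suc k)) + ((- 1# * 1#) * (1# * D (withoutRow0Col1 H) (suc k)) + 0#)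
      ≈⟨ tidy _ _ _ ⟩
    H 0 0 * D (withoutRow0Col0 H) (suc k) - D (withoutRow0Col1 H) (suc k) ∎
    where
    M = leading H (suc (suc k))
    rest = ΣFin k (λ j → ((- 1#) ^ toℕ (fsuc (fsuc j))) * (H 0 (suc (suc (toℕ j))) * det (suc k) (minor M (fsuc (fsuc j)))))
    rest≈0 : rest ≈ 0#
    rest≈0 = ΣFin-vanishes k _ λ j →
      trans (*-congˡ (trans (*-congʳ (IsUnitHessenberg.above-zero h 0 (suc (suc (toℕ j))) (N.s≤s (N.s≤s N.z≤n)))) (zeroˡ _)))
            (zeroʳ _)
    second-minor : ∀ r c → minor M (fsuc fzero) r c ≈ leading (withoutRow0Col1 H) (suc k) r c
    second-minor r fzero    = refl
    second-minor r (fsuc c) = refl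
    tidy : ∀ a b d → 1# * (a * b) + ((- 1# * 1#) * (1# * d) + 0#) ≈ a * b - d
    tidy = solve 3 (λ a b d → :1 :* (a :* b) :+ ((:- :1 :* :1) :* (:1 :* d) :+ :0)
                             := a :* b :- d) refl

  -- Row m of a unit Hessenberg matrix annihilates the signed minors:
  -- its first entry is the alternating sum of the others weighted by D.
  -- Induction on m, for all such matrices at once, via  D-expand.
  hessenberg-row : ∀ {H} → IsUnitHessenberg H → ∀ m →
    Alt (suc m) (λ k → H m (suc k) * D H (suc k)) ≈ H m 0
  hessenberg-row {H} h zero =
    trans (+-congʳ (*-congˡ (*-cong (IsUnitHessenberg.super-one h 0) (D-one H)))) (unit-laws (H 0 0))
    where
    unit-laws : ∀ a → 1# * (1# * a) + 0# ≈ a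
    unit-laws = solve 1 (λ a → :1 :* (:1 :* a) :+ :0 := a) refl
  hessenberg-row {H} h (suc m) = begin
    Alt (suc (suc m)) (λ k → H (suc m) (suc k) * D H (suc k))
      ≈⟨ Alt-suc (suc m) (λ k → H (suc m) (suc k) * D H (suc k)) ⟩
    H (suc m) 1 * D H 1 - Alt (suc m) (λ k → H (suc m) (suc (suc k)) * D H (suc (suc k)))
      ≈⟨ +-cong (*-congˡ (D-one H)) (-‿cong (S-cong (suc m) (λ k → *-congˡ {sign k} (expand k)))) ⟩
    H (suc m) 1 * H 0 0 - Alt (suc m) (λ k → H 0 0 * rowA k - rowK k)
      ≈⟨ +-congˡ (-‿cong (Alt-linear (suc m) (H 0 0) rowA rowK)) ⟩
    H (suc m) 1 * H 0 0 - (H 0 0 * Alt (suc m) rowA - Alt (suc m) rowK)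
      ≈⟨ +-congˡ (-‿cong (+-cong (*-congˡ (hessenberg-row (withoutRow0Col0-hessenberg h) m))
                                  (-‿cong (hessenberg-row (withoutRow0Col1-hessenberg h) m)))) ⟩
    H (suc m) 1 * H 0 0 - (H 0 0 * H (suc m) 1 - H (suc m) 0)
      ≈⟨ cancel (H (suc m) 1) (H 0 0) (H (suc m) 0) ⟩
    H (suc m) 0 ∎
    where
    rowA rowK : ℕ → Carrier
    rowA k = H (suc m) (suc (suc k)) * D (withoutRow0Col0 H) (suc k)
    rowK k = H (suc m) (suc (suc k)) * D (withoutRow0Col1 H) (suc k)
    expand : ∀ k → H (suc m) (suc (suc k)) * D H (suc (suc k)) ≈ H 0 0 * rowA k - rowK k
    expand k = trans (*-congˡ (D-expand h k)) (distribute _ _ _ _)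
      where
      distribute : ∀ e a p q → e * (a * p - q) ≈ a * (e * p) - e * q
      distribute = solve 4 (λ e a p q → e :* (a :* p :- q) := a :* (e :* p) :- e :* q) refl
    cancel : ∀ b a c → b * a - (a * b - c) ≈ c
    cancel = solve 3 (λ b a c → b :* a :- (a :* b :- c) := c) refl

  hessenberg-kernel : ∀ {H} → IsUnitHessenberg H → ∀ m →
    Alt (suc (suc m)) (λ k → H m k * D H k) ≈ 0#
  hessenberg-kernel {H} h m = begin
    Alt (suc (suc m)) (λ k → H m k * D H k)
      ≈⟨ Alt-suc (suc m) (λ k → H m k * D H k) ⟩
    H m 0 * 1# - Alt (suc m) (λ k → H m (suc k) * D H (suc k))
      ≈⟨ +-cong (*-identityʳ _) (-‿cong (hessenberg-row h m)) ⟩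
    H m 0 - H m 0
      ≈⟨ -‿inverseʳ _ ⟩
    0# ∎

module NaturalEmbedding {c ℓ : Level} (R : CommutativeRing c ℓ) where
  open CommutativeRing R hiding (zero)
  open RingDefs R using (ι)
  open import Algebra.Properties.Semiring.Mult semiring using (×-homo-+)

  ι-+ : ∀ a b → ι (a N.+ b) ≈ ι a + ι b
  ι-+ = ×-homo-+ 1#

  ι-cong : ∀ {a b} → a ≡ b → ι a ≈ ι b
  ι-cong a≡b = reflexive (≡.cong ι a≡b)

  ι-one : ∀ {a} → a ≡ 1 → ι a ≈ 1#
  ι-one a≡1 = trans (ι-cong a≡1) (+-identityʳ 1#)

  vanishing-term : ∀ {a} y → a ≡ 0 → ι a * y ≈ 0#
  vanishing-term y a≡0 = trans (*-congʳ (ι-cong a≡0)) (zeroˡ y)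

module BinomialTransform {c ℓ : Level} (R : CommutativeRing c ℓ) where
  open CommutativeRing R hiding (zero)
  open RingDefs R using (ι)
  open FiniteSums R
  open NaturalEmbedding R
  open IntegerCoefficientSolver R using (solve; _:=_; _:+_)
  open import Data.Sum using (inj₁; inj₂)
  open import Relation.Binary.Reasoning.Setoid setoid

  B : ℕ → (ℕ → Carrier) → Carrier
  B m w = S (suc m) (λ k → ι (m C k) * w k)

  next prev : (ℕ → Carrier) → ℕ → Carrier
  next w k = w (suc k)
  prev w zero    = 0#
  prev w (suc k) = w k

  -- C(m, m+1) = 0: the transform may be summed one step further.
  B-pad : ∀ m w → S (suc (suc m)) (λ k → ι (m C k) * w k) ≈ B m w
  B-pad m w = S-pad (suc m) (λ k → ι (m C k) * w k) (vanishing-term (w (suc m)) (k>n⇒nCk≡0 (NP.n<1+n m)))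

  B-pascal : ∀ m w → B (suc m) w ≈ B m w + B m (next w)
  B-pascal m w = begin
    ι (suc m C 0) * w 0 + S (suc m) (λ k → ι (suc m C suc k) * w (suc k))
      ≈⟨ +-congˡ (S-cong (suc m) split) ⟩
    ι (suc m C 0) * w 0 + S (suc m) (λ k → ι (m C k) * w (suc k) + g k)
      ≈⟨ +-congˡ (S-+ (suc m) (λ k → ι (m C k) * w (suc k)) g) ⟩
    ι (suc m C 0) * w 0 + (B m (next w) + S (suc m) g)
      ≈⟨ +-congˡ (+-congˡ (S-pad m g (vanishing-term (w (suc m)) (k>n⇒nCk≡0 (NP.n<1+n m))))) ⟩
    ι (suc m C 0) * w 0 + (B m (next w) + S m g)
      ≈⟨ regroup _ _ _ ⟩
    (ι (m C 0) * w 0 + S m g) + B m (next w) ∎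
    where
    g : ℕ → Carrier
    g k = ι (m C suc k) * w (suc k)
    split : ∀ k → ι (suc m C suc k) * w (suc k) ≈ ι (m C k) * w (suc k) + g k
    split k = trans (*-congʳ (trans (ι-cong (≡.sym (pascal m k))) (ι-+ (m C k) (m C suc k))))
                    (distribʳ (w (suc k)) _ _)
    regroup : ∀ a b t → a + (b + t) ≈ (a + t) + b
    regroup = solve 3 (λ a b t → a :+ (b :+ t) := (a :+ t) :+ b) refl

  B-+ : ∀ m f g → B m (λ k → f k + g k) ≈ B m f + B m g
  B-+ m f g = trans (S-cong (suc m) (λ k → distribˡ (ι (m C k)) (f k) (g k)))
                    (S-+ (suc m) (λ k → ι (m C k) * f k) (λ k → ι (m C k) * g k))

  B-* : ∀ m a f → B m (λ k → a * f k) ≈ a * B m f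
  B-* m a f = trans (S-cong (suc m) (λ k → x∙yz≈y∙xz (ι (m C k)) a (f k)))
                    (S-* (suc m) a (λ k → ι (m C k) * f k))
    where open import Algebra.Properties.CommutativeSemigroup *-commutativeSemigroup using (x∙yz≈y∙xz)

  -- The transform is unitriangular, hence injective: a sequence all of
  -- whose transforms vanish is zero.
  B-vanishing : ∀ u → (∀ m → B m u ≈ 0#) → ∀ l → u l ≈ 0#
  B-vanishing u Bu≈0 l = below (suc l) l (NP.n<1+n l)
    where
    below : ∀ m l → l N.< m → u l ≈ 0#
    below (suc m) l (N.s≤s l≤m) with NP.m≤n⇒m<n∨m≡n l≤m
    ... | inj₁ l<m    = below m l l<m
    ... | inj₂ ≡.refl = begin
      u l           ≈⟨ *-identityˡ (u l) ⟨
      1# * u l      ≈⟨ *-congʳ (ι-one (nCn≡1 l)) ⟨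
      f l           ≈⟨ +-identityˡ (f l) ⟨
      0# + f l      ≈⟨ +-congʳ (S-vanishes l f (λ k k<l → trans (*-congˡ (below l k k<l)) (zeroʳ _))) ⟨
      S l f + f l   ≈⟨ S-last l f ⟨
      B l u         ≈⟨ Bu≈0 l ⟩
      0#            ∎
      where
      f : ℕ → Carrier
      f k = ι (l C k) * u k

module TheMatrix {c ℓ : Level} (R : CommutativeRing c ℓ) (x : CommutativeRing.Carrier R) where
  open CommutativeRing R hiding (zero)
  open RingDefs R using (ι)
  open FiniteSums R
  open AlternatingSums R
  open UnitHessenberg R
  open NaturalEmbedding R
  open BinomialTransform R
  open IntegerCoefficientSolver R using (solve; _:=_; _:+_; _:*_; :-_; _:-_; :0; :1)
  open import Algebra.Properties.Ring ring using (x∙y⁻¹≈ε⇒x≈y)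
  open import Relation.Binary.Reasoning.Setoid setoid

  A : Matrix
  A i j = ι (i C j) * x + ι ((i N.+ 2) C (j N.+ 1))

  A-hessenberg : IsUnitHessenberg A
  A-hessenberg = record { above-zero = above-zero ; super-one = super-one }
    where
    above-zero : ∀ i j → suc (suc i) N.≤ j → A i j ≈ 0#
    above-zero i j 2+i≤j =
      trans (+-cong (vanishing-term x (k>n⇒nCk≡0 (NP.≤-trans (NP.n≤1+n (suc i)) 2+i≤j)))
                    (ι-cong (k>n⇒nCk≡0 (≡.subst₂ N._<_ (NP.+-comm 2 i) (NP.+-comm 1 j) (N.s≤s 2+i≤j)))))
            (+-identityʳ 0#)
    super-one : ∀ i → A i (suc i) ≈ 1#
    super-one i =
      trans (+-cong (vanishing-term x (k>n⇒nCk≡0 (NP.n<1+n i)))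
                    (ι-one (≡.trans (≡.cong₂ _C_ (NP.+-comm i 2) (NP.+-comm (suc i) 1)) (nCn≡1 (suc (suc i))))))
            (+-identityˡ 1#)

  L : (ℕ → Carrier) → ℕ → Carrier
  L w l = x * w l + ((prev w l + w l) + (w l + next w l))

  -- Pairing row m of A with w gives the m-th binomial transform of L w,
  -- by Pascal's rule  C(m+2,k+1) = C(m,k-1) + 2 C(m,k) + C(m,k+1).
  row-transform : ∀ m w → S (suc (suc m)) (λ k → A m k * w k) ≈ B m (L w)
  row-transform m w = begin
    S (suc (suc m)) (λ k → A m k * w k)
      ≈⟨ S-cong (suc (suc m)) (λ k → expand (ι (m C k)) x (ι ((m N.+ 2) C (k N.+ 1))) (w k)) ⟩
    S (suc (suc m)) (λ k → x * (ι (m C k) * w k) + upper k)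
      ≈⟨ S-+ (suc (suc m)) (λ k → x * (ι (m C k) * w k)) upper ⟩
    S (suc (suc m)) (λ k → x * (ι (m C k) * w k)) + S (suc (suc m)) upper
      ≈⟨ +-cong (trans (S-* (suc (suc m)) x (λ k → ι (m C k) * w k)) (*-congˡ (B-pad m w))) upper≈B ⟩
    x * B m w + B (suc (suc m)) (prev w)
      ≈⟨ +-congˡ (trans (B-pascal (suc m) (prev w)) (+-cong (B-pascal m (prev w)) (B-pascal m w))) ⟩
    x * B m w + ((B m (prev w) + B m w) + (B m w + B m (next w)))
      ≈⟨ B-L ⟨
    B m (L w) ∎
    where
    expand : ∀ a x b y → (a * x + b) * y ≈ x * (a * y) + b * y
    expand = solve 4 (λ a x b y → (a :* x :+ b) :* y := x :* (a :* y) :+ b :* y) refl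
    upper : ℕ → Carrier
    upper k = ι ((m N.+ 2) C (k N.+ 1)) * w k
    -- B (m+2) (prev w) is the same sum with a vanishing first term.
    upper≈B : S (suc (suc m)) upper ≈ B (suc (suc m)) (prev w)
    upper≈B = trans (S-cong (suc (suc m)) (λ k → *-congʳ {w k} (ι-cong (≡.cong₂ _C_ (NP.+-comm m 2) (NP.+-comm k 1)))))
                    (sym (trans (+-congʳ (zeroʳ _)) (+-identityˡ _)))
    B-L : B m (L w) ≈ x * B m w + ((B m (prev w) + B m w) + (B m w + B m (next w)))
    B-L = trans (B-+ m (λ l → x * w l) (λ l → (prev w l + w l) + (w l + next w l)))
            (+-cong (B-* m x w)
              (trans (B-+ m (λ l → prev w l + w l) (λ l → w l + next w l))
                     (+-cong (B-+ m (prev w) w) (B-+ m w (next w)))))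

  signed-minors : ℕ → Carrier
  signed-minors k = sign k * D A k

  -- Every binomial transform of L (signed minors) is a row of A applied to
  -- the signed minors, hence zero; so L kills the signed minors.
  L-signed-minors : ∀ l → L signed-minors l ≈ 0#
  L-signed-minors = B-vanishing (L signed-minors) λ m → begin
    B m (L signed-minors)                                   ≈⟨ row-transform m signed-minors ⟨
    S (suc (suc m)) (λ k → A m k * signed-minors k)         ≈⟨ S-cong (suc (suc m)) (λ k → x∙yz≈y∙xz (A m k) (sign k) (D A k)) ⟩
    Alt (suc (suc m)) (λ k → A m k * D A k)                 ≈⟨ hessenberg-kernel A-hessenberg m ⟩
    0#                                                      ∎
    where open import Algebra.Properties.CommutativeSemigroup *-commutativeSemigroup using (x∙yz≈y∙xz)

  -- L vanishing at 0 says D 1 = x + 2 (recall D 0 = 1).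
  minor-one : D A 1 ≈ x + 1# + 1#
  minor-one = sym (x∙y⁻¹≈ε⇒x≈y _ _ (trans (sym (regroup x (D A 1))) (L-signed-minors 0)))
    where
    regroup : ∀ x d → x * (1# * 1#) + ((0# + 1# * 1#) + (1# * 1# + (- 1#) * d)) ≈ (x + 1# + 1#) - d
    regroup = solve 2 (λ x d → x :* (:1 :* :1) :+ ((:0 :+ :1 :* :1) :+ (:1 :* :1 :+ (:- :1) :* d))
                             := (x :+ :1 :+ :1) :- d) refl

  -- L vanishing at l+1 is (-1)^l (D (l+2) - (x+2) D (l+1) + D l) = 0.
  minor-recurrence : ∀ l → D A (suc (suc l)) ≈ (x + 1# + 1#) * D A (suc l) - D A l
  minor-recurrence l = x∙y⁻¹≈ε⇒x≈y _ _ (sign-cancel l _ (trans (sym (factor x (sign l) (D A l) (D A (suc l)) (D A (suc (suc l)))))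
                                                            (L-signed-minors (suc l))))
    where
    factor : ∀ x s d₀ d₁ d₂ → x * (- s * d₁) + ((s * d₀ + - s * d₁) + (- s * d₁ + - - s * d₂))
                              ≈ s * (d₂ - ((x + 1# + 1#) * d₁ - d₀))
    factor = solve 5 (λ x s d₀ d₁ d₂ →
      x :* (:- s :* d₁) :+ ((s :* d₀ :+ :- s :* d₁) :+ (:- s :* d₁ :+ :- (:- s) :* d₂))
      := s :* (d₂ :- ((x :+ :1 :+ :1) :* d₁ :- d₀))) refl

module RightHandSide {c ℓ : Level} (R : CommutativeRing c ℓ) (x : CommutativeRing.Carrier R) where
  open CommutativeRing R hiding (zero)
  open RingDefs R using (ι; rhsSum; _^_)
  open FiniteSums R
  open NaturalEmbedding R
  open BinomialFacts using (rhsCoeff; mulX; rhsCoeff-vanishes; rhsCoeff-recurrence)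
  open IntegerCoefficientSolver R using (solve; _:=_; _:+_; _:*_; _:-_; :0; :1)
  open import Relation.Binary.Reasoning.Setoid setoid

  eval : ℕ → (ℕ → ℕ) → Carrier
  eval n c = S n (λ h → ι (c h) * x ^ h)

  eval-cong : ∀ n {c d} → (∀ h → c h ≡ d h) → eval n c ≈ eval n d
  eval-cong n c≡d = S-cong n (λ h → *-congʳ (ι-cong (c≡d h)))

  eval-+ : ∀ n c d → eval n (λ h → c h N.+ d h) ≈ eval n c + eval n d
  eval-+ n c d = trans (S-cong n (λ h → trans (*-congʳ (ι-+ (c h) (d h))) (distribʳ (x ^ h) _ _)))
                       (S-+ n (λ h → ι (c h) * x ^ h) (λ h → ι (d h) * x ^ h))

  eval-pad : ∀ n c → c n ≡ 0 → eval (suc n) c ≈ eval n c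
  eval-pad n c cn≡0 = S-pad n (λ h → ι (c h) * x ^ h) (vanishing-term (x ^ n) cn≡0)

  eval-mulX : ∀ n c → eval (suc n) (mulX c) ≈ x * eval n c
  eval-mulX n c = begin
    ι 0 * 1# + S n (λ h → ι (c h) * (x * x ^ h))   ≈⟨ +-cong (zeroˡ 1#) (S-cong n (λ h → x∙yz≈y∙xz (ι (c h)) x (x ^ h))) ⟩
    0# + S n (λ h → x * (ι (c h) * x ^ h))         ≈⟨ +-identityˡ _ ⟩
    S n (λ h → x * (ι (c h) * x ^ h))              ≈⟨ S-* n x (λ h → ι (c h) * x ^ h) ⟩
    x * eval n c                                   ∎
    where open import Algebra.Properties.CommutativeSemigroup *-commutativeSemigroup using (x∙yz≈y∙xz)

  F≈eval : ∀ n → rhsSum n x ≈ eval (suc n) (rhsCoeff n)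
  F≈eval n = Σℕ≈S (suc n) (λ h → ι (rhsCoeff n h) * x ^ h)

  rhs-zero : rhsSum 0 x ≈ 1#
  rhs-zero = trans (+-identityˡ _) (trans (*-congʳ (ι-one (nCn≡1 1))) (*-identityʳ 1#))

  rhs-one : rhsSum 1 x ≈ x + 1# + 1#
  rhs-one = evaluate x
    where
    evaluate : ∀ x → (0# + (1# + (1# + 0#)) * 1#) + (1# + 0#) * (x * 1#) ≈ x + 1# + 1#
    evaluate = solve 1 (λ x → (:0 :+ (:1 :+ (:1 :+ :0)) :* :1) :+ (:1 :+ :0) :* (x :* :1)
                            := x :+ :1 :+ :1) refl

  -- F (n+2) + F n = 2 F (n+1) + x F (n+1), summing rhsCoeff-recurrence
  -- over the common length 3 + n of the three sums.
  rhs-outer-sum : ∀ n → rhsSum (suc (suc n)) x + rhsSum n x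
                        ≈ (rhsSum (suc n) x + rhsSum (suc n) x) + x * rhsSum (suc n) x
  rhs-outer-sum n = begin
    F₂ + F₀
      ≈⟨ +-cong (F≈eval (suc (suc n))) F₀-wide ⟩
    eval len (rhsCoeff (suc (suc n))) + eval len (rhsCoeff n)
      ≈⟨ eval-+ len (rhsCoeff (suc (suc n))) (rhsCoeff n) ⟨
    eval len (λ h → rhsCoeff (suc (suc n)) h N.+ rhsCoeff n h)
      ≈⟨ eval-cong len (rhsCoeff-recurrence n) ⟩
    eval len (λ h → (c₁ h N.+ c₁ h) N.+ mulX c₁ h)
      ≈⟨ trans (eval-+ len (λ h → c₁ h N.+ c₁ h) (mulX c₁)) (+-congʳ (eval-+ len c₁ c₁)) ⟩
    (eval len c₁ + eval len c₁) + eval len (mulX c₁)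
      ≈⟨ +-cong (+-cong F₁-wide F₁-wide) (trans (*-congˡ (F≈eval (suc n))) (sym (eval-mulX (suc (suc n)) c₁))) ⟨
    (F₁ + F₁) + x * F₁ ∎
    where
    F₀ = rhsSum n x
    F₁ = rhsSum (suc n) x
    F₂ = rhsSum (suc (suc n)) x
    c₁ = rhsCoeff (suc n)
    len = suc (suc (suc n))
    F₀-wide : F₀ ≈ eval len (rhsCoeff n)
    F₀-wide = trans (F≈eval n)
      (sym (trans (eval-pad (suc (suc n)) (rhsCoeff n) (rhsCoeff-vanishes n (suc (suc n)) (NP.m≤n⇒m≤1+n (NP.n<1+n n))))
                  (eval-pad (suc n) (rhsCoeff n) (rhsCoeff-vanishes n (suc n) (NP.n<1+n n)))))
    F₁-wide : F₁ ≈ eval len c₁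
    F₁-wide = trans (F≈eval (suc n))
      (sym (eval-pad (suc (suc n)) c₁ (rhsCoeff-vanishes (suc n) (suc (suc n)) (NP.n<1+n (suc n)))))

  rhs-recurrence : ∀ n → rhsSum (suc (suc n)) x ≈ (x + 1# + 1#) * rhsSum (suc n) x - rhsSum n x
  rhs-recurrence n = begin
    F₂                          ≈⟨ add-subtract F₂ F₀ ⟩
    (F₂ + F₀) - F₀              ≈⟨ +-congʳ (rhs-outer-sum n) ⟩
    ((F₁ + F₁) + x * F₁) - F₀   ≈⟨ collect x F₁ F₀ ⟩
    (x + 1# + 1#) * F₁ - F₀     ∎
    where
    F₀ = rhsSum n x
    F₁ = rhsSum (suc n) x
    F₂ = rhsSum (suc (suc n)) x
    add-subtract : ∀ a b → a ≈ (a + b) - b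
    add-subtract = solve 2 (λ a b → a := (a :+ b) :- b) refl
    collect : ∀ x g f → ((g + g) + x * g) - f ≈ (x + 1# + 1#) * g - f
    collect = solve 3 (λ x g f → ((g :+ g) :+ x :* g) :- f := (x :+ :1 :+ :1) :* g :- f) refl

module SecondOrderRecurrence {c ℓ : Level} (R : CommutativeRing c ℓ) where
  open CommutativeRing R hiding (zero)
  open import Data.Product using (_,_; proj₁) renaming (_×_ to _∧_)

  Satisfies : Carrier → (ℕ → Carrier) → Set ℓ
  Satisfies t a = ∀ l → a (suc (suc l)) ≈ t * a (suc l) - a l

  recurrence-unique : ∀ t a b → Satisfies t a → Satisfies t b →
    a 0 ≈ b 0 → a 1 ≈ b 1 → ∀ l → a l ≈ b l
  recurrence-unique t a b rec-a rec-b a₀≈b₀ a₁≈b₁ l = proj₁ (consecutive l)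
    where
    consecutive : ∀ l → a l ≈ b l ∧ a (suc l) ≈ b (suc l)
    consecutive zero    = a₀≈b₀ , a₁≈b₁
    consecutive (suc l) with consecutive l
    ... | aₗ≈bₗ , aₗ₊₁≈bₗ₊₁ =
      aₗ₊₁≈bₗ₊₁ , trans (rec-a l) (trans (+-cong (*-congˡ aₗ₊₁≈bₗ₊₁) (-‿cong aₗ≈bₗ)) (sym (rec-b l)))

mainTheorem10 : {c ℓ : Level} (R : CommutativeRing c ℓ) (x : CommutativeRing.Carrier R) (n : ℕ) →
    CommutativeRing._≈_ R (RingDefs.det R (suc n) (RingDefs.binomMatrix R (suc n) x)) (RingDefs.rhsSum R (suc n) x)
-- The matrix of the statement is the leading block of A, so its
-- determinant is D A (suc n).  Minors and right-hand side solve the same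
-- recurrence with t = x + 2 and agree at 0 and 1.
mainTheorem10 R x n =
  recurrence-unique (x + 1# + 1#) (D A) (λ m → rhsSum m x) minor-recurrence rhs-recurrence
                    (sym rhs-zero) (trans minor-one (sym rhs-one)) (suc n)
  where
  open CommutativeRing R using (_+_; 1#; sym; trans)
  open RingDefs R using (rhsSum)
  open UnitHessenberg R using (D)
  open TheMatrix R x using (A; minor-one; minor-recurrence)
  open RightHandSide R x using (rhs-zero; rhs-one; rhs-recurrence)
  open SecondOrderRecurrence R using (recurrence-unique)
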